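{- For each $n\ge 0$, a primitive modified ascent sequence of length $n$ avoids $221$ if and only if it avoids $2321$, i.e. $\mathrm{Prim}_n(221)=\mathrm{Prim}_n(2321)$. Furthermore, for each $n\ge1$, $\{\mathfrak{st}(x): x\in\mathrm{Prim}_n(221)\}=1\oplus\mathrm{Sym}_{n-1}(32\text{ - }1)$.
   Context: A Cayley permutation of length $n$ is a word $x=x_1\cdots x_n$ of positive integers whose set of values is $\{1,\dots,k\}$ for some $k\le n$. $x$ contains $y=y_1\cdots y_k$ if there are indices $i_1<\cdots<i_k$ with $x_{i_s}<x_{i_t}\iff y_s<y_t$ and $x_{i_s}=x_{i_t}\iff y_s=y_t$ for all $s,t$; otherwise $x$ avoids $y$. The ascent tops of $x$ are the pairs $(1,x_1)$ and $(i,x_i)$ with $1<i\le n$ and $x_{i-1}<x_i$; the leftmost copies are the pairs $(\min\{i:x_i=j\},j)$ for $1\le j\le\max(x)$. A modified ascent sequence is a Cayley permutation whose set of ascent tops equals its set of leftmost copies; it is primitive if it has no two consecutive equal entries; $\mathrm{Prim}_n(y)$ is the set of primitive ones of length $n$ avoiding $y$. Standardization: if $a_i$ is the number of entries of $x$ equal to $i$, $\mathfrak{st}(x)$ is the permutation obtained by replacing the $a_i$ copies of $i$, from left to right, by $a_1+\cdots+a_{i-1}+1,\dots,a_1+\cdots+a_i$. A permutation $q=q_1\cdots q_m$ avoids $32\text{ - }1$ if there are no indices $i,j$ with $i+1<j$ and $q_i>q_{i+1}>q_j$. $1\oplus\mathrm{Sym}_{n-1}(32\text{ - }1)$ is the set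 of permutations $p$ of $\{1,\dots,n\}$ with $p_1=1$ such that $(p_2-1)\cdots(p_n-1)$ avoids $32\text{ - }1$. -}

module Defs where

open import Data.Nat using (ℕ; zero; suc; _+_; _<_; _≤_; _∸_; _⊔_)
open import Data.Nat.Properties using (_<?_; _≟_)
open import Data.Fin using (Fin; toℕ) renaming (zero to fzero; suc to fsuc)
open import Data.Vec using (Vec; []; _∷_; lookup; head; tail; map; foldr; tabulate)
open import Data.Product using (Σ; _×_; _,_; ∃; ∃-syntax)
open import Data.Sum using (_⊎_)
open import Relation.Binary.PropositionalEquality using (_≡_; _≢_)
open import Relation.Nullary using (¬_; does)
open import Function.Bundles using (_⇔_)
open import Data.Bool using (Bool; true; false; if_then_else_)

-- Words of length n over positive integers are vectors of naturals; positions are Fin n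
-- (position i : Fin n corresponds to the paper's index toℕ i + 1).

maxV : ∀ {n} → Vec ℕ n → ℕ
maxV = foldr _ _⊔_ 0

IsCayley : ∀ {n} → Vec ℕ n → Set
IsCayley {n} x =
  (∀ (i : Fin n) → 1 ≤ lookup x i) ×
  (∀ (j : ℕ) → 1 ≤ j → j ≤ maxV x → ∃[ i ] lookup x i ≡ j)

Contains : ∀ {n k} → Vec ℕ n → Vec ℕ k → Set
Contains {n} {k} x y =
  Σ (Fin k → Fin n) λ f →
    (∀ s t → toℕ s < toℕ t → toℕ (f s) < toℕ (f t)) ×
    (∀ s t → (lookup x (f s) < lookup x (f t) ⇔ lookup y s < lookup y t)
           × (lookup x (f s) ≡ lookup x (f t) ⇔ lookup y s ≡ lookup y t))

Avoids : ∀ {n k} → Vec ℕ n → Vec ℕ k → Set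
Avoids x y = ¬ Contains x y

IsAscentTop : ∀ {n} → Vec ℕ n → Fin n × ℕ → Set
IsAscentTop {n} x (i , v) =
  v ≡ lookup x i ×
  (toℕ i ≡ 0 ⊎ Σ (Fin n) λ h → suc (toℕ h) ≡ toℕ i × lookup x h < lookup x i)

IsLeftmostCopy : ∀ {n} → Vec ℕ n → Fin n × ℕ → Set
IsLeftmostCopy {n} x (i , j) =
  1 ≤ j × j ≤ maxV x × lookup x i ≡ j ×
  (∀ (h : Fin n) → lookup x h ≡ j → toℕ i ≤ toℕ h)

IsModAscent : ∀ {n} → Vec ℕ n → Set
IsModAscent x = IsCayley x × (∀ p → IsAscentTop x p ⇔ IsLeftmostCopy x p)

IsPrimitive : ∀ {n} → Vec ℕ n → Set
IsPrimitive {n} x =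
  ∀ (i j : Fin n) → suc (toℕ i) ≡ toℕ j → lookup x i ≢ lookup x j

InPrim : ∀ {n k} → Vec ℕ k → Vec ℕ n → Set
InPrim y x = IsModAscent x × IsPrimitive x × Avoids x y

count : ∀ {n} → (Fin n → Bool) → ℕ
count {zero} P = 0
count {suc n} P = (if P fzero then 1 else 0) + count {n} (λ i → P (fsuc i))

-- standardization: the entry at position i (with value v = x_i) becomes
-- a_1 + ... + a_{v-1} + r, where a_1 + ... + a_{v-1} is the number of entries
-- smaller than v and r is the number of copies of v at positions ≤ i
st : ∀ {n} → Vec ℕ n → Vec ℕ n
st {n} x = tabulate λ i →
  count (λ h → does (lookup x h <? lookup x i)) +
  count (λ h → if does (lookup x h ≟ lookup x i) then does (toℕ h <? suc (toℕ i)) else false)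

IsPerm : ∀ {n} → Vec ℕ n → Set
IsPerm {n} p =
  (∀ (i : Fin n) → 1 ≤ lookup p i × lookup p i ≤ n) ×
  (∀ (i j : Fin n) → lookup p i ≡ lookup p j → i ≡ j)

Avoids32-1 : ∀ {m} → Vec ℕ m → Set
Avoids32-1 {m} q =
  ¬ (Σ (Fin m) λ i → Σ (Fin m) λ i' → Σ (Fin m) λ j →
       suc (toℕ i) ≡ toℕ i' × toℕ i' < toℕ j ×
       lookup q i' < lookup q i × lookup q j < lookup q i')

In1⊕Sym32-1 : ∀ {m} → Vec ℕ (suc m) → Set
In1⊕Sym32-1 p = IsPerm p × head p ≡ 1 × Avoids32-1 (map (λ v → v ∸ 1) (tail p))

pat221 : Vec ℕ 3
pat221 = 2 ∷ 2 ∷ 1 ∷ []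

pat2321 : Vec ℕ 4
pat2321 = 2 ∷ 3 ∷ 2 ∷ 1 ∷ []

-- In a modified ascent sequence the leftmost copies are exactly the ascent tops, so an entry
-- repeating an earlier value is not an ascent top; in a primitive one its left neighbour is then
-- strictly larger. Thus an occurrence a < b < c of 221 extends to the occurrence a, b-1, b, c of
-- 2321, and conversely 2321 contains 221.
--
-- Standardization numbers the positions in the order "smaller value, or equal value further
-- left". For x in Prim(221) we have x_1 = 1, and a 32-1 in st x at positions a, a+1, c forces
-- x_{a+1} < x_a, so x_{a+1} repeats some earlier x_d and d, a+1, c is a 221. Conversely, for p in
-- 1 ⊕ Sym(32-1) let x_i be the number of ascent tops k of p with p_k ≤ p_i. Avoidance of 32-1
-- makes p increase from left to right on each level set of x, whence st x = p, and the ascent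
-- tops of x are those of p, which are exactly the leftmost copies in x.

module Submission where

open import Defs
open import Data.Bool using (Bool; true; false; T; _∧_; if_then_else_)
open import Data.Bool.Properties using (T-∧)
open import Data.Empty using (⊥-elim)
open import Data.Fin as Fin using (Fin; toℕ; inject₁; #_) renaming (zero to fzero; suc to fsuc)
open import Data.Fin.Properties as Finₚ using (toℕ-injective; toℕ-inject₁)
open import Data.Nat using (ℕ; zero; suc; _+_; _∸_; _⊔_; _≤_; _<_; _≡ᵇ_; _≤ᵇ_; _<ᵇ_; z≤n; s≤s)
open import Data.Nat.Properties
open import Data.Product using (Σ; ∃; ∃-syntax; _×_; _,_; proj₁; proj₂) renaming (map to mapΣ)
open import Data.Sum using (_⊎_; inj₁; inj₂; [_,_]′; reduce)
open import Data.Unit using (tt)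
open import Data.Vec using (Vec; []; _∷_; lookup; map; tabulate)
open import Data.Vec.Properties using (lookup∘tabulate; lookup-map; tabulate-cong; tabulate∘lookup)
open import Function using (_∘_; id)
open import Function.Bundles using (_⇔_; mk⇔)
open Function.Bundles.Equivalence using (to; from)
open import Function.Properties.Equivalence using () renaming (trans to ⇔-trans; sym to ⇔-sym)
open import Relation.Binary.Core using (_Preserves_⟶_)
open import Relation.Binary.Definitions using (tri<; tri≈; tri>)
open import Relation.Binary.PropositionalEquality
open import Relation.Nullary using (¬_; yes; no; does)
open import Relation.Nullary.Decidable using (T?)

-- Counting positions

infix 4 _⊆ᵇ_
_⊆ᵇ_ : ∀ {n} → (Fin n → Bool) → (Fin n → Bool) → Set
P ⊆ᵇ Q = ∀ i → T (P i) → T (Q i)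

count-none : ∀ {n} (P : Fin n → Bool) → (∀ i → ¬ T (P i)) → count P ≡ 0
count-none {zero}  P none = refl
count-none {suc n} P none with P fzero | none fzero
... | true  | ¬p₀ = ⊥-elim (¬p₀ tt)
... | false | _   = count-none (P ∘ fsuc) (none ∘ fsuc)

count-all : ∀ {n} (P : Fin n → Bool) → (∀ i → T (P i)) → count P ≡ n
count-all {zero}  P all = refl
count-all {suc n} P all with P fzero | all fzero
... | true  | _ = cong suc (count-all (P ∘ fsuc) (all ∘ fsuc))
... | false | ()

count-mono : ∀ {n} (P Q : Fin n → Bool) → P ⊆ᵇ Q → count P ≤ count Q
count-mono {zero}  P Q P⊆Q = z≤n
count-mono {suc n} P Q P⊆Q with P fzero | Q fzero | P⊆Q fzero
... | true  | true  | _   = s≤s (count-mono (P ∘ fsuc) (Q ∘ fsuc) (P⊆Q ∘ fsuc))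
... | true  | false | p⇒q = ⊥-elim (p⇒q tt)
... | false | true  | _   = m≤n⇒m≤1+n (count-mono (P ∘ fsuc) (Q ∘ fsuc) (P⊆Q ∘ fsuc))
... | false | false | _   = count-mono (P ∘ fsuc) (Q ∘ fsuc) (P⊆Q ∘ fsuc)

count-< : ∀ {n} (P Q : Fin n → Bool) → P ⊆ᵇ Q → ∀ k → ¬ T (P k) → T (Q k) → count P < count Q
count-< P Q P⊆Q fzero ¬pₖ qₖ with P fzero | Q fzero
... | true  | _     = ⊥-elim (¬pₖ tt)
... | false | true  = s≤s (count-mono (P ∘ fsuc) (Q ∘ fsuc) (P⊆Q ∘ fsuc))
count-< P Q P⊆Q (fsuc k) ¬pₖ qₖ with P fzero | Q fzero | P⊆Q fzero
... | true  | true  | _   = s≤s (count-< (P ∘ fsuc) (Q ∘ fsuc) (P⊆Q ∘ fsuc) k ¬pₖ qₖ)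
... | true  | false | p⇒q = ⊥-elim (p⇒q tt)
... | false | true  | _   = m≤n⇒m≤1+n (count-< (P ∘ fsuc) (Q ∘ fsuc) (P⊆Q ∘ fsuc) k ¬pₖ qₖ)
... | false | false | _   = count-< (P ∘ fsuc) (Q ∘ fsuc) (P⊆Q ∘ fsuc) k ¬pₖ qₖ

count-pos : ∀ {n} (P : Fin n → Bool) k → T (P k) → 0 < count P
count-pos {n} P k pₖ =
  subst (_< count P) (count-none {n} (λ _ → false) (λ _ ())) (count-< (λ _ → false) P (λ _ ()) k (λ ()) pₖ)

count-<⇒∃ : ∀ {n} (P Q : Fin n → Bool) → count P < count Q → ∃[ k ] ¬ T (P k) × T (Q k)
count-<⇒∃ {suc n} P Q lt with P fzero in p₀ | Q fzero in q₀
... | false | true  = fzero , subst T p₀ , subst T (sym q₀) tt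
... | true  | true  = mapΣ fsuc id (count-<⇒∃ (P ∘ fsuc) (Q ∘ fsuc) (≤-pred lt))
... | true  | false = mapΣ fsuc id (count-<⇒∃ (P ∘ fsuc) (Q ∘ fsuc) (<-trans (n<1+n _) lt))
... | false | false = mapΣ fsuc id (count-<⇒∃ (P ∘ fsuc) (Q ∘ fsuc) lt)

count-≤-suc : ∀ {n} (P Q : Fin n → Bool) →
  (∀ h h′ → ¬ T (P h) → T (Q h) → ¬ T (P h′) → T (Q h′) → h ≡ h′) → count Q ≤ suc (count P)
count-≤-suc {zero}  P Q uniq = z≤n
count-≤-suc {suc n} P Q uniq
  with P fzero | Q fzero | uniq fzero
     | count-≤-suc (P ∘ fsuc) (Q ∘ fsuc)
         (λ h h′ a b c d → Finₚ.suc-injective (uniq (fsuc h) (fsuc h′) a b c d))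
... | false | true  | uniq₀ | _ = s≤s (count-mono (Q ∘ fsuc) (P ∘ fsuc) Q′⊆P′)
  where
  Q′⊆P′ : (Q ∘ fsuc) ⊆ᵇ (P ∘ fsuc)
  Q′⊆P′ h q with P (fsuc h) | uniq₀ (fsuc h) (λ ()) tt
  ... | true  | _ = tt
  ... | false | u = Finₚ.0≢1+n (u (λ ()) q)
... | true  | true  | _ | rest = s≤s rest
... | true  | false | _ | rest = m≤n⇒m≤1+n rest
... | false | false | _ | rest = rest

count-disjoint : ∀ {n} (A B R : Fin n → Bool) → (∀ i → T (A i) → ¬ T (B i)) →
  A ⊆ᵇ R → B ⊆ᵇ R → count A + count B ≤ count R
count-disjoint {zero}  A B R disj A⊆R B⊆R = z≤n
count-disjoint {suc n} A B R disj A⊆R B⊆R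
  with A fzero | B fzero | R fzero | disj fzero | A⊆R fzero | B⊆R fzero
     | count-disjoint (A ∘ fsuc) (B ∘ fsuc) (R ∘ fsuc) (disj ∘ fsuc) (A⊆R ∘ fsuc) (B⊆R ∘ fsuc)
... | true  | true  | _     | d | _ | _ | _    = ⊥-elim (d tt tt)
... | true  | false | false | _ | a | _ | _    = ⊥-elim (a tt)
... | false | true  | false | _ | _ | b | _    = ⊥-elim (b tt)
... | true  | false | true  | _ | _ | _ | rest = s≤s rest
... | false | true  | true  | _ | _ | _ | rest = ≤-trans (≤-reflexive (+-suc _ _)) (s≤s rest)
... | false | false | true  | _ | _ | _ | rest = m≤n⇒m≤1+n rest
... | false | false | false | _ | _ | _ | rest = rest

count-cover : ∀ {n} (A B R : Fin n → Bool) → (∀ i → T (R i) → T (A i) ⊎ T (B i)) →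
  count R ≤ count A + count B
count-cover {zero}  A B R cover = z≤n
count-cover {suc n} A B R cover
  with A fzero | B fzero | R fzero | cover fzero
     | count-cover (A ∘ fsuc) (B ∘ fsuc) (R ∘ fsuc) (cover ∘ fsuc)
... | true  | true  | true  | _ | rest = s≤s (≤-trans rest (+-monoʳ-≤ _ (n≤1+n _)))
... | true  | false | true  | _ | rest = s≤s rest
... | false | true  | true  | _ | rest = ≤-trans (s≤s rest) (≤-reflexive (sym (+-suc _ _)))
... | false | false | true  | c | _    = ⊥-elim (reduce (c tt))
... | a     | b     | false | _ | rest =
  ≤-trans rest (+-mono-≤ (m≤n+m _ (if a then 1 else 0)) (m≤n+m _ (if b then 1 else 0)))

-- Pattern containment

increasing-by-adjacent : ∀ {k} (g : Fin (suc k) → ℕ) → (∀ s → g (inject₁ s) < g (fsuc s)) →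
  g Preserves Fin._<_ ⟶ _<_
increasing-by-adjacent g step {fzero}  {fsuc fzero}    _ = step fzero
increasing-by-adjacent {suc k} g step {fzero} {fsuc (fsuc t)} _ =
  <-trans (step fzero) (increasing-by-adjacent (g ∘ fsuc) (step ∘ fsuc) {fzero} {fsuc t} (s≤s z≤n))
increasing-by-adjacent {suc k} g step {fsuc s} {fsuc t} (s≤s s<t) =
  increasing-by-adjacent (g ∘ fsuc) (step ∘ fsuc) s<t

module _ {m} {g : Fin m → ℕ} (g-inc : g Preserves Fin._<_ ⟶ _<_) where

  increasing-reflects-< : ∀ {i j} → g i < g j → toℕ i < toℕ j
  increasing-reflects-< {i} {j} gi<gj with Finₚ.<-cmp i j
  ... | tri< i<j _ _ = i<j
  ... | tri≈ _ refl _ = ⊥-elim (<-irrefl refl gi<gj)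
  ... | tri> _ _ j<i = ⊥-elim (<-asym gi<gj (g-inc j<i))

  increasing-injective : ∀ {i j} → g i ≡ g j → i ≡ j
  increasing-injective {i} {j} gi≡gj with Finₚ.<-cmp i j
  ... | tri< i<j _ _ = ⊥-elim (<-irrefl gi≡gj (g-inc i<j))
  ... | tri≈ _ i≡j _ = i≡j
  ... | tri> _ _ j<i = ⊥-elim (<-irrefl (sym gi≡gj) (g-inc j<i))

same-order : ∀ {m} {a b : Fin m → ℕ} → a Preserves Fin._<_ ⟶ _<_ → b Preserves Fin._<_ ⟶ _<_ →
  ∀ i j → (a i < a j ⇔ b i < b j) × (a i ≡ a j ⇔ b i ≡ b j)
same-order {a = a} {b} a-inc b-inc i j =
  mk⇔ (b-inc ∘ increasing-reflects-< a-inc) (a-inc ∘ increasing-reflects-< b-inc) ,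
  mk⇔ (cong b ∘ increasing-injective a-inc) (cong a ∘ increasing-injective b-inc)

contains-by-ranks : ∀ {n k m} (x : Vec ℕ n) (y : Vec ℕ k) (f : Fin k → Fin n) (r : Fin k → Fin m)
  {a b : Fin m → ℕ} → (toℕ ∘ f) Preserves Fin._<_ ⟶ _<_ →
  a Preserves Fin._<_ ⟶ _<_ → b Preserves Fin._<_ ⟶ _<_ →
  (∀ s → lookup x (f s) ≡ a (r s)) → y ≡ tabulate (b ∘ r) → Contains x y
contains-by-ranks x y f r {b = b} f-inc a-inc b-inc x∘f≡a∘r y≡b∘r = f , (λ _ _ → f-inc) , order
  where
  y-rank : ∀ s → lookup y s ≡ b (r s)
  y-rank s = trans (cong (λ v → lookup v s) y≡b∘r) (lookup∘tabulate (b ∘ r) s)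
  order : ∀ s t → (lookup x (f s) < lookup x (f t) ⇔ lookup y s < lookup y t)
                × (lookup x (f s) ≡ lookup x (f t) ⇔ lookup y s ≡ lookup y t)
  order s t rewrite x∘f≡a∘r s | x∘f≡a∘r t | y-rank s | y-rank t = same-order a-inc b-inc (r s) (r t)

contains-trans : ∀ {n k l} {x : Vec ℕ n} {z : Vec ℕ l} {y : Vec ℕ k} →
  Contains x z → Contains z y → Contains x y
contains-trans (f , f-inc , f-order) (g , g-inc , g-order) =
  f ∘ g , (λ s t → f-inc (g s) (g t) ∘ g-inc s t) ,
  λ s t → ⇔-trans (proj₁ (f-order (g s) (g t))) (proj₁ (g-order s t)) ,
          ⇔-trans (proj₂ (f-order (g s) (g t))) (proj₂ (g-order s t))

Occurrence221 : ∀ {n} → Vec ℕ n → Set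
Occurrence221 {n} x = Σ (Fin n × Fin n × Fin n) λ (a , b , c) →
  toℕ a < toℕ b × toℕ b < toℕ c × lookup x a ≡ lookup x b × lookup x c < lookup x b

contains221⇔ : ∀ {n} (x : Vec ℕ n) → Contains x pat221 ⇔ Occurrence221 x
contains221⇔ x = mk⇔ extract build
  where
  extract : Contains x pat221 → Occurrence221 x
  extract (f , f-inc , order) =
    (f (# 0) , f (# 1) , f (# 2)) , f-inc (# 0) (# 1) (s≤s z≤n) , f-inc (# 1) (# 2) (s≤s (s≤s z≤n)) ,
    from (proj₂ (order (# 0) (# 1))) refl ,
    from (proj₁ (order (# 2) (# 1))) (s≤s (s≤s z≤n))
  build : Occurrence221 x → Contains x pat221
  build ((a , b , c) , a<b , b<c , xa≡xb , xc<xb) =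
    contains-by-ranks x pat221 (lookup (a ∷ b ∷ c ∷ [])) (lookup (# 1 ∷ # 1 ∷ # 0 ∷ []))
      {a = lookup (lookup x c ∷ lookup x b ∷ [])} {b = suc ∘ toℕ}
      (increasing-by-adjacent _ λ { fzero → a<b ; (fsuc fzero) → b<c })
      (increasing-by-adjacent _ λ { fzero → xc<xb })
      s≤s
      (λ { fzero → xa≡xb ; (fsuc fzero) → refl ; (fsuc (fsuc fzero)) → refl })
      refl

contains2321 : ∀ {n} (x : Vec ℕ n) {a h b c} → toℕ a < toℕ h → toℕ h < toℕ b → toℕ b < toℕ c →
  lookup x a ≡ lookup x b → lookup x c < lookup x b → lookup x b < lookup x h → Contains x pat2321
contains2321 x {a} {h} {b} {c} a<h h<b b<c xa≡xb xc<xb xb<xh =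
  contains-by-ranks x pat2321 (lookup (a ∷ h ∷ b ∷ c ∷ [])) (lookup (# 1 ∷ # 2 ∷ # 1 ∷ # 0 ∷ []))
    {a = lookup (lookup x c ∷ lookup x b ∷ lookup x h ∷ [])} {b = suc ∘ toℕ}
    (increasing-by-adjacent _ λ { fzero → a<h ; (fsuc fzero) → h<b ; (fsuc (fsuc fzero)) → b<c })
    (increasing-by-adjacent _ λ { fzero → xc<xb ; (fsuc fzero) → xb<xh })
    s≤s
    (λ { fzero → xa≡xb ; (fsuc fzero) → refl ; (fsuc (fsuc fzero)) → refl
       ; (fsuc (fsuc (fsuc fzero))) → refl })
    refl

pat2321-contains-pat221 : Contains pat2321 pat221
pat2321-contains-pat221 =
  contains-by-ranks {m = 2} pat2321 pat221 (lookup (# 0 ∷ # 2 ∷ # 3 ∷ [])) (lookup (# 1 ∷ # 1 ∷ # 0 ∷ []))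
    {a = suc ∘ toℕ} {b = suc ∘ toℕ}
    (increasing-by-adjacent _ λ { fzero → s≤s z≤n ; (fsuc fzero) → s≤s (s≤s (s≤s z≤n)) })
    s≤s s≤s
    (λ { fzero → refl ; (fsuc fzero) → refl ; (fsuc (fsuc fzero)) → refl })
    refl

avoids221⇒avoids2321 : ∀ {n} (x : Vec ℕ n) → Avoids x pat221 → Avoids x pat2321
avoids221⇒avoids2321 x avoids221 occurs =
  avoids221 (contains-trans {x = x} {z = pat2321} {y = pat221} occurs pat2321-contains-pat221)

-- Ascent tops and modified ascent sequences

adjacent⇒inject₁ : ∀ {n} {h : Fin (suc n)} {k : Fin n} → suc (toℕ h) ≡ toℕ (fsuc k) → h ≡ inject₁ k
adjacent⇒inject₁ {k = k} e = toℕ-injective (trans (suc-injective e) (sym (toℕ-inject₁ k)))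

inject₁-adjacent : ∀ {n} (k : Fin n) → suc (toℕ (inject₁ k)) ≡ toℕ (fsuc k)
inject₁-adjacent k = cong suc (toℕ-inject₁ k)

lookup≤maxV : ∀ {n} (x : Vec ℕ n) i → lookup x i ≤ maxV x
lookup≤maxV (v ∷ x) fzero    = m≤m⊔n v (maxV x)
lookup≤maxV (v ∷ x) (fsuc i) = ≤-trans (lookup≤maxV x i) (m≤n⊔m v (maxV x))

maxV-attained : ∀ {n} (x : Vec ℕ (suc n)) → ∃[ i ] maxV x ≡ lookup x i
maxV-attained (v ∷ [])    = fzero , ⊔-identityʳ v
maxV-attained (v ∷ w ∷ x) with maxV-attained (w ∷ x) | ≤-total v (maxV (w ∷ x))
... | i , eq | inj₁ v≤ = fsuc i , trans (m≤n⇒m⊔n≡n v≤) eq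
... | _      | inj₂ v≥ = fzero , m≥n⇒m⊔n≡m v≥

Leftmost : ∀ {n} → Vec ℕ n → Fin n → Set
Leftmost x i = ∀ h → lookup x h ≡ lookup x i → toℕ i ≤ toℕ h

leftmost-occurrence : ∀ {n} (x : Vec ℕ n) j → ∃[ i ] lookup x i ≡ lookup x j × Leftmost x i
leftmost-occurrence (v ∷ x) j with v ≟ lookup (v ∷ x) j
... | yes v≡ = fzero , v≡ , λ _ _ → z≤n
leftmost-occurrence (v ∷ x) fzero    | no v≢ = ⊥-elim (v≢ refl)
leftmost-occurrence (v ∷ x) (fsuc j) | no v≢ with leftmost-occurrence x j
... | i , eq , min = fsuc i , eq , earliest
  where
  earliest : Leftmost (v ∷ x) (fsuc i)
  earliest fzero    e = ⊥-elim (v≢ (trans e eq))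
  earliest (fsuc h) e = s≤s (min h e)

¬leftmost⇒earlier-copy : ∀ {n} (x : Vec ℕ n) b → ¬ Leftmost x b →
  ∃[ a ] toℕ a < toℕ b × lookup x a ≡ lookup x b
¬leftmost⇒earlier-copy x b ¬min with leftmost-occurrence x b
... | a , eq , min with <-cmp (toℕ a) (toℕ b)
...   | tri< a<b _ _ = a , a<b , eq
...   | tri≈ _ a≡b _ = ⊥-elim (¬min (subst (Leftmost x) (toℕ-injective a≡b) min))
...   | tri> _ _ a>b = ⊥-elim (<⇒≱ a>b (min b (sym eq)))

ascentTop? : ∀ {n} → Vec ℕ n → Fin n → Bool
ascentTop? x fzero    = true
ascentTop? x (fsuc k) = lookup x (inject₁ k) <ᵇ lookup x (fsuc k)

isAscentTop⇔ : ∀ {n} (x : Vec ℕ n) i → IsAscentTop x (i , lookup x i) ⇔ T (ascentTop? x i)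
isAscentTop⇔ x fzero    = mk⇔ (λ _ → tt) (λ _ → refl , inj₁ refl)
isAscentTop⇔ x (fsuc k) =
  mk⇔ top⇒ (λ xₖ<xₖ₊₁ → refl , inj₂ (inject₁ k , inject₁-adjacent k , <ᵇ⇒< _ _ xₖ<xₖ₊₁))
  where
  top⇒ : IsAscentTop x (fsuc k , lookup x (fsuc k)) → T (ascentTop? x (fsuc k))
  top⇒ (_ , inj₂ (h , h+1≡ , xₕ<)) =
    <⇒<ᵇ (subst (λ h → lookup x h < lookup x (fsuc k)) (adjacent⇒inject₁ h+1≡) xₕ<)

ascentTop?-adjacent : ∀ {n} (x : Vec ℕ n) {h b} → suc (toℕ h) ≡ toℕ b →
  ascentTop? x b ≡ (lookup x h <ᵇ lookup x b)
ascentTop?-adjacent x {b = fsuc k} h+1≡ rewrite adjacent⇒inject₁ h+1≡ = refl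

isLeftmostCopy⇔ : ∀ {n} (x : Vec ℕ n) i → 1 ≤ lookup x i → IsLeftmostCopy x (i , lookup x i) ⇔ Leftmost x i
isLeftmostCopy⇔ x i xᵢ≥1 = mk⇔ (λ (_ , _ , _ , min) → min) (λ min → xᵢ≥1 , lookup≤maxV x i , refl , min)

isModAscent⇔ : ∀ {n} (x : Vec ℕ n) → IsModAscent x ⇔ (IsCayley x × ∀ i → T (ascentTop? x i) ⇔ Leftmost x i)
isModAscent⇔ x = mk⇔
  (λ (cayley , tops) → cayley , λ i →
    ⇔-trans (⇔-sym (isAscentTop⇔ x i))
            (⇔-trans (tops (i , lookup x i)) (isLeftmostCopy⇔ x i (proj₁ cayley i))))
  (λ (cayley , tops) → cayley , λ _ → mk⇔ (top⇒copy cayley tops) (copy⇒top cayley tops))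
  where
  module _ (cayley : IsCayley x) (tops : ∀ i → T (ascentTop? x i) ⇔ Leftmost x i) where
    top⇒copy : ∀ {i v} → IsAscentTop x (i , v) → IsLeftmostCopy x (i , v)
    top⇒copy {i} top@(refl , _) =
      from (isLeftmostCopy⇔ x i (proj₁ cayley i))
        (to (tops i) (to (isAscentTop⇔ x i) top))
    copy⇒top : ∀ {i v} → IsLeftmostCopy x (i , v) → IsAscentTop x (i , v)
    copy⇒top {i} copy@(_ , _ , refl , _) =
      from (isAscentTop⇔ x i)
        (from (tops i) (to (isLeftmostCopy⇔ x i (proj₁ cayley i)) copy))

module ModifiedAscent {n} (x : Vec ℕ n) (modAscent : IsModAscent x) where

  cayley : IsCayley x
  cayley = proj₁ (to (isModAscent⇔ x) modAscent)

  top⇔leftmost : ∀ i → T (ascentTop? x i) ⇔ Leftmost x i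
  top⇔leftmost = proj₂ (to (isModAscent⇔ x) modAscent)

  repeat⇒weak-descent : ∀ {a b} → toℕ a < toℕ b → lookup x a ≡ lookup x b →
    ∃[ h ] suc (toℕ h) ≡ toℕ b × lookup x b ≤ lookup x h
  repeat⇒weak-descent {a} {fsuc k} a<b xₐ≡xb =
    inject₁ k , inject₁-adjacent k ,
    ≮⇒≥ (λ xₕ<xb → <⇒≱ a<b (to (top⇔leftmost (fsuc k)) (<⇒<ᵇ xₕ<xb) a xₐ≡xb))

  descent⇒repeat : ∀ {h b} → suc (toℕ h) ≡ toℕ b → lookup x b < lookup x h →
    ∃[ a ] toℕ a < toℕ b × lookup x a ≡ lookup x b
  descent⇒repeat {b = b} h+1≡b xb<xₕ = ¬leftmost⇒earlier-copy x b (not-top ∘ from (top⇔leftmost b))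
    where
    not-top : ¬ T (ascentTop? x b)
    not-top top = <-asym xb<xₕ (<ᵇ⇒< _ _ (subst T (ascentTop?-adjacent x h+1≡b) top))

  repeat⇒descent : IsPrimitive x → ∀ {a b} → toℕ a < toℕ b → lookup x a ≡ lookup x b →
    ∃[ h ] suc (toℕ h) ≡ toℕ b × lookup x b < lookup x h
  repeat⇒descent prim a<b xₐ≡xb with repeat⇒weak-descent a<b xₐ≡xb
  ... | h , h+1≡b , xb≤xₕ = h , h+1≡b , ≤∧≢⇒< xb≤xₕ (λ xb≡xₕ → prim h _ h+1≡b (sym xb≡xₕ))

  221⇒2321 : IsPrimitive x → Contains x pat221 → Contains x pat2321
  221⇒2321 prim occurs with to (contains221⇔ x) occurs
  ... | (a , b , c) , a<b , b<c , xₐ≡xb , xc<xb with repeat⇒descent prim a<b xₐ≡xb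
  ...   | h , h+1≡b , xb<xₕ = contains2321 x a<h (≤-reflexive h+1≡b) b<c xₐ≡xb xc<xb xb<xₕ
    where
    a≢h : a ≢ h
    a≢h a≡h = <-irrefl (trans (sym xₐ≡xb) (cong (lookup x) a≡h)) xb<xₕ
    a<h : toℕ a < toℕ h
    a<h = ≤∧≢⇒< (≤-pred (≤-trans a<b (≤-reflexive (sym h+1≡b)))) (a≢h ∘ toℕ-injective)

modAscent-head≡1 : ∀ {m} {x : Vec ℕ (suc m)} → IsModAscent x → lookup x fzero ≡ 1
modAscent-head≡1 {x = x} modAscent =
  let j , xⱼ≡1 = proj₂ cayley 1 ≤-refl (≤-trans (proj₁ cayley fzero) (lookup≤maxV x fzero))
      i , xᵢ≡xⱼ , min = leftmost-occurrence x j
  in leftmost-one-is-first i (trans xᵢ≡xⱼ xⱼ≡1) min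
  where
  open ModifiedAscent x modAscent
  leftmost-one-is-first : ∀ i → lookup x i ≡ 1 → Leftmost x i → lookup x fzero ≡ 1
  leftmost-one-is-first fzero    x₀≡1 _   = x₀≡1
  leftmost-one-is-first (fsuc k) xᵢ≡1 min = ⊥-elim (<⇒≱ xₖ<1 (proj₁ cayley (inject₁ k)))
    where
    xₖ<1 : lookup x (inject₁ k) < 1
    xₖ<1 = subst (lookup x (inject₁ k) <_) xᵢ≡1 (<ᵇ⇒< _ _ (from (top⇔leftmost (fsuc k)) min))

-- Standardization

InInterval : ∀ {n} → (Fin n → ℕ) → ℕ → ℕ → Fin n → Bool
InInterval P a d h = (a <ᵇ P h) ∧ (P h ≤ᵇ a + d)

inInterval⇔ : ∀ {n} (P : Fin n → ℕ) a d h → T (InInterval P a d h) ⇔ (a < P h × P h ≤ a + d)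
inInterval⇔ P a d h = ⇔-trans T-∧ (mk⇔ (λ (l , u) → <ᵇ⇒< a (P h) l , ≤ᵇ⇒≤ (P h) (a + d) u)
                                       (λ (l , u) → <⇒<ᵇ l , ≤⇒≤ᵇ u))

count-inInterval : ∀ {n} {P : Fin n → ℕ} → (∀ i j → P i ≡ P j → i ≡ j) →
  ∀ a d → count (InInterval P a d) ≤ d
count-inInterval {P = P} _ a zero = ≤-reflexive (count-none _ empty)
  where
  empty : ∀ h → ¬ T (InInterval P a 0 h)
  empty h t with to (inInterval⇔ P a 0 h) t
  ... | a<P , P≤a+0 = <⇒≱ a<P (subst (P h ≤_) (+-identityʳ a) P≤a+0)
count-inInterval {P = P} P-injective a (suc d) =
  ≤-trans (count-≤-suc (InInterval P a d) (InInterval P a (suc d)) at-most-one)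
          (s≤s (count-inInterval P-injective a d))
  where
  top-value : ∀ {h} → ¬ T (InInterval P a d h) → T (InInterval P a (suc d) h) → P h ≡ a + suc d
  top-value {h} ∉ ∈ with to (inInterval⇔ P a (suc d) h) ∈
  ... | a<P , P≤ = ≤-antisym P≤ (subst (_≤ P h) (sym (+-suc a d)) (≰⇒> P≰a+d))
    where
    P≰a+d : ¬ P h ≤ a + d
    P≰a+d P≤a+d = ∉ (from (inInterval⇔ P a d h) (a<P , P≤a+d))
  at-most-one : ∀ h h′ → ¬ T (InInterval P a d h) → T (InInterval P a (suc d) h) →
                ¬ T (InInterval P a d h′) → T (InInterval P a (suc d) h′) → h ≡ h′
  at-most-one h h′ ∉ ∈ ∉′ ∈′ = P-injective h h′ (trans (top-value ∉ ∈) (sym (top-value ∉′ ∈′)))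

perm-count : ∀ {n} {p : Vec ℕ n} → IsPerm p → ∀ {v} → v ≤ n → count (λ h → lookup p h ≤ᵇ v) ≡ v
perm-count {n} {p} (bounds , injective) {v} v≤n = ≤-antisym at-most at-least
  where
  P = lookup p
  #≤v #>v : ℕ
  #≤v = count (λ h → P h ≤ᵇ v)
  #>v = count (λ h → v <ᵇ P h)
  at-most : #≤v ≤ v
  at-most = ≤-trans (count-mono _ (InInterval P 0 v) λ h P≤v →
                       from (inInterval⇔ P 0 v h) (proj₁ (bounds h) , ≤ᵇ⇒≤ (P h) v P≤v))
                    (count-inInterval injective 0 v)
  above : #>v ≤ n ∸ v
  above = ≤-trans (count-mono _ (InInterval P v (n ∸ v)) λ h v<P →
                     from (inInterval⇔ P v (n ∸ v) h)
                       (<ᵇ⇒< v (P h) v<P , subst (P h ≤_) (sym (m+[n∸m]≡n v≤n)) (proj₂ (bounds h))))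
                  (count-inInterval injective v (n ∸ v))
  total : n ≤ #≤v + #>v
  total = subst (_≤ #≤v + #>v) (count-all {n} (λ _ → true) _)
            (count-cover _ _ (λ _ → true) λ h _ →
              [ (λ P≤v → inj₁ (≤⇒≤ᵇ P≤v)) , (λ v<P → inj₂ (<⇒<ᵇ v<P)) ]′ (≤-<-connex (P h) v))
  at-least : v ≤ #≤v
  at-least = +-cancelʳ-≤ (n ∸ v) v _
    (≤-trans (≤-reflexive (m+[n∸m]≡n v≤n)) (≤-trans total (+-monoʳ-≤ _ above)))

module Standardization {n} (x : Vec ℕ n) where

  below : Fin n → Fin n → Bool
  below i h = does (lookup x h <? lookup x i)

  copyUpTo : Fin n → Fin n → Bool
  copyUpTo i h = if does (lookup x h ≟ lookup x i) then does (toℕ h <? suc (toℕ i)) else false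

  rank : Fin n → ℕ
  rank i = count (below i) + count (copyUpTo i)

  lookup-st : ∀ i → lookup (st x) i ≡ rank i
  lookup-st = lookup∘tabulate rank

  below⇔ : ∀ i h → T (below i h) ⇔ lookup x h < lookup x i
  below⇔ i h = mk⇔ (<ᵇ⇒< _ _) <⇒<ᵇ

  copyUpTo⇔ : ∀ i h → T (copyUpTo i h) ⇔ (lookup x h ≡ lookup x i × toℕ h ≤ toℕ i)
  copyUpTo⇔ i h with lookup x h ≡ᵇ lookup x i in eq
  ... | true  = mk⇔ (λ t → ≡ᵇ⇒≡ _ _ (subst T (sym eq) tt) , ≤-pred (<ᵇ⇒< _ _ t))
                    (λ (_ , h≤i) → <⇒<ᵇ (s≤s h≤i))
  ... | false = mk⇔ (λ ()) (λ (xₕ≡xᵢ , _) → subst T eq (≡⇒≡ᵇ _ _ xₕ≡xᵢ))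

  infix 4 _≺_
  _≺_ : Fin n → Fin n → Set
  h ≺ i = lookup x h < lookup x i ⊎ (lookup x h ≡ lookup x i × toℕ h < toℕ i)

  ≺-trichotomous : ∀ h i → h ≺ i ⊎ h ≡ i ⊎ i ≺ h
  ≺-trichotomous h i with <-cmp (lookup x h) (lookup x i) | Finₚ.<-cmp h i
  ... | tri< xₕ<xᵢ _ _ | _              = inj₁ (inj₁ xₕ<xᵢ)
  ... | tri> _ _ xᵢ<xₕ | _              = inj₂ (inj₂ (inj₁ xᵢ<xₕ))
  ... | tri≈ _ xₕ≡xᵢ _ | tri< h<i _ _   = inj₁ (inj₂ (xₕ≡xᵢ , h<i))
  ... | tri≈ _ _ _     | tri≈ _ h≡i _   = inj₂ (inj₁ h≡i)
  ... | tri≈ _ xₕ≡xᵢ _ | tri> _ _ i<h   = inj₂ (inj₂ (inj₂ (sym xₕ≡xᵢ , i<h)))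

  private
    copyUpTo-self : ∀ i → T (copyUpTo i i)
    copyUpTo-self i = from (copyUpTo⇔ i i) (refl , ≤-refl)

    below-disjoint : ∀ i h → T (below i h) → ¬ T (copyUpTo i h)
    below-disjoint i h b c = <-irrefl (proj₁ (to (copyUpTo⇔ i h) c)) (to (below⇔ i h) b)

  rank-positive : ∀ i → 1 ≤ rank i
  rank-positive i = ≤-trans (count-pos (copyUpTo i) i (copyUpTo-self i)) (m≤n+m _ _)

  rank≤n : ∀ i → rank i ≤ n
  rank≤n i = subst (rank i ≤_) (count-all (λ _ → true) _)
    (count-disjoint (below i) (copyUpTo i) (λ _ → true) (below-disjoint i) _ _)

  rank-strictMono : ∀ {h i} → h ≺ i → rank h < rank i
  rank-strictMono {h} {i} (inj₁ xₕ<xᵢ) = ≤-<-trans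
    (count-disjoint (below h) (copyUpTo h) (below i) (below-disjoint h)
      (λ j b → from (below⇔ i j) (<-trans (to (below⇔ h j) b) xₕ<xᵢ))
      (λ j c → from (below⇔ i j) (subst (_< lookup x i) (sym (proj₁ (to (copyUpTo⇔ h j) c))) xₕ<xᵢ)))
    (m<m+n _ (count-pos (copyUpTo i) i (copyUpTo-self i)))
  rank-strictMono {h} {i} (inj₂ (xₕ≡xᵢ , h<i)) = +-mono-≤-<
    (count-mono (below h) (below i) λ j b →
      from (below⇔ i j) (subst (lookup x j <_) xₕ≡xᵢ (to (below⇔ h j) b)))
    (count-< (copyUpTo h) (copyUpTo i) copy⊆ i
      (λ c → <⇒≱ h<i (proj₂ (to (copyUpTo⇔ h i) c))) (copyUpTo-self i))
    where
    copy⊆ : copyUpTo h ⊆ᵇ copyUpTo i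
    copy⊆ j c with to (copyUpTo⇔ h j) c
    ... | xⱼ≡xₕ , j≤h = from (copyUpTo⇔ i j) (trans xⱼ≡xₕ xₕ≡xᵢ , ≤-trans j≤h (<⇒≤ h<i))

  rank-injective : ∀ i j → rank i ≡ rank j → i ≡ j
  rank-injective i j rᵢ≡rⱼ with ≺-trichotomous i j
  ... | inj₁ i≺j        = ⊥-elim (<-irrefl rᵢ≡rⱼ (rank-strictMono i≺j))
  ... | inj₂ (inj₁ i≡j) = i≡j
  ... | inj₂ (inj₂ j≺i) = ⊥-elim (<-irrefl (sym rᵢ≡rⱼ) (rank-strictMono j≺i))

  rank-minimum : ∀ i → (∀ h → h ≢ i → i ≺ h) → rank i ≡ 1
  rank-minimum i i≺ = ≤-antisym (+-mono-≤ (≤-reflexive nothing-below) only-itself) (rank-positive i)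
    where
    nothing-below : count (below i) ≡ 0
    nothing-below = count-none (below i) λ h b →
      let xₕ<xᵢ = to (below⇔ i h) b in
      [ <-asym xₕ<xᵢ , (λ (xᵢ≡xₕ , _) → <-irrefl (sym xᵢ≡xₕ) xₕ<xᵢ) ]′
        (i≺ h (λ { refl → <-irrefl refl xₕ<xᵢ }))
    copy⇒self : ∀ h → T (copyUpTo i h) → h ≡ i
    copy⇒self h c with to (copyUpTo⇔ i h) c | Finₚ._≟_ h i
    ... | _             | yes h≡i = h≡i
    ... | xₕ≡xᵢ , h≤i | no h≢i  =
      ⊥-elim ([ <-irrefl (sym xₕ≡xᵢ) , (λ (_ , i<h) → <⇒≱ i<h h≤i) ]′ (i≺ h h≢i))
    only-itself : count (copyUpTo i) ≤ 1
    only-itself = subst (λ c → count (copyUpTo i) ≤ suc c) (count-none {n} (λ _ → false) (λ _ ()))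
      (count-≤-suc (λ _ → false) (copyUpTo i) λ h h′ _ c _ c′ →
        trans (copy⇒self h c) (sym (copy⇒self h′ c′)))

  st-isPerm : IsPerm (st x)
  st-isPerm =
    (λ i → subst (λ r → 1 ≤ r × r ≤ n) (sym (lookup-st i)) (rank-positive i , rank≤n i)) ,
    λ i j eq → rank-injective i j (trans (sym (lookup-st i)) (trans eq (lookup-st j)))

  st-descent : ∀ {h i} → toℕ h < toℕ i → lookup (st x) i < lookup (st x) h → lookup x i < lookup x h
  st-descent {h} {i} h<i stᵢ<stₕ = ≰⇒> λ xₕ≤xᵢ →
    <-asym (subst₂ _<_ (lookup-st i) (lookup-st h) stᵢ<stₕ) (rank-strictMono (h≺i xₕ≤xᵢ))
    where
    h≺i : lookup x h ≤ lookup x i → h ≺ i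
    h≺i xₕ≤xᵢ = [ inj₁ , (λ xₕ≡xᵢ → inj₂ (xₕ≡xᵢ , h<i)) ]′ (m≤n⇒m<n∨m≡n xₕ≤xᵢ)

  st-unique : ∀ {p : Vec ℕ n} → IsPerm p → (∀ {h i} → h ≺ i → lookup p h < lookup p i) → st x ≡ p
  st-unique {p} perm ≺⇒< = trans (tabulate-cong rank≡p) (tabulate∘lookup p)
    where
    atMost : Fin n → Fin n → Bool
    atMost i h = lookup p h ≤ᵇ lookup p i
    below⊆ : ∀ i → below i ⊆ᵇ atMost i
    below⊆ i h b = ≤⇒≤ᵇ (<⇒≤ (≺⇒< (inj₁ (to (below⇔ i h) b))))
    copy⊆ : ∀ i → copyUpTo i ⊆ᵇ atMost i
    copy⊆ i h c with to (copyUpTo⇔ i h) c | Finₚ._≟_ h i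
    ... | _             | yes refl = ≤⇒≤ᵇ (≤-refl {lookup p i})
    ... | xₕ≡xᵢ , h≤i | no h≢i   =
      ≤⇒≤ᵇ (<⇒≤ (≺⇒< (inj₂ (xₕ≡xᵢ , ≤∧≢⇒< h≤i (h≢i ∘ toℕ-injective)))))
    covered : ∀ i h → T (atMost i h) → T (below i h) ⊎ T (copyUpTo i h)
    covered i h pₕ≤pᵢ with ≺-trichotomous h i
    ... | inj₁ (inj₁ xₕ<xᵢ)          = inj₁ (from (below⇔ i h) xₕ<xᵢ)
    ... | inj₁ (inj₂ (xₕ≡xᵢ , h<i)) = inj₂ (from (copyUpTo⇔ i h) (xₕ≡xᵢ , <⇒≤ h<i))
    ... | inj₂ (inj₁ refl)           = inj₂ (copyUpTo-self i)
    ... | inj₂ (inj₂ i≺h)            = ⊥-elim (<⇒≱ (≺⇒< i≺h) (≤ᵇ⇒≤ _ _ pₕ≤pᵢ))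
    rank≡p : ∀ i → rank i ≡ lookup p i
    rank≡p i = trans
      (≤-antisym (count-disjoint (below i) (copyUpTo i) (atMost i)
                   (below-disjoint i) (below⊆ i) (copy⊆ i))
                 (count-cover (below i) (copyUpTo i) (atMost i) (covered i)))
      (perm-count {p = p} perm (proj₂ (proj₁ perm i)))

in1⊕Sym32-1⇔ : ∀ {m} (p : Vec ℕ (suc m)) → In1⊕Sym32-1 p ⇔ (IsPerm p × lookup p fzero ≡ 1 × Avoids32-1 p)
in1⊕Sym32-1⇔ (p₀ ∷ q) =
  mk⇔ (λ (perm , p₀≡1 , avoids) → perm , p₀≡1 , widen perm p₀≡1 avoids)
      (λ (perm , p₀≡1 , avoids) → perm , p₀≡1 , narrow avoids)
  where
  narrow : Avoids32-1 (p₀ ∷ q) → Avoids32-1 (map (_∸ 1) q)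
  narrow avoids (i , i′ , j , i+1≡i′ , i′<j , lt , lt′) =
    avoids (fsuc i , fsuc i′ , fsuc j , cong suc i+1≡i′ , s≤s i′<j , reflect i′ i lt , reflect j i′ lt′)
    where
    reflect : ∀ u v → lookup (map (_∸ 1) q) u < lookup (map (_∸ 1) q) v → lookup q u < lookup q v
    reflect u v lt rewrite lookup-map u (_∸ 1) q | lookup-map v (_∸ 1) q =
      ≰⇒> (λ qᵥ≤qᵤ → <⇒≱ lt (∸-monoˡ-≤ 1 qᵥ≤qᵤ))
  widen : IsPerm (p₀ ∷ q) → p₀ ≡ 1 → Avoids32-1 (map (_∸ 1) q) → Avoids32-1 (p₀ ∷ q)
  widen (bounds , _) p₀≡1 _ (fzero , b , _ , _ , _ , p_b<p₀ , _) =
    <⇒≱ (subst (lookup (p₀ ∷ q) b <_) p₀≡1 p_b<p₀) (proj₁ (bounds b))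
  widen (bounds , _) _ avoids (fsuc i , fsuc i′ , fsuc j , i+1≡i′ , i′<j , lt , lt′) =
    avoids (i , i′ , j , suc-injective i+1≡i′ , ≤-pred i′<j , shift i′ i lt , shift j i′ lt′)
    where
    shift : ∀ u v → lookup q u < lookup q v → lookup (map (_∸ 1) q) u < lookup (map (_∸ 1) q) v
    shift u v lt rewrite lookup-map u (_∸ 1) q | lookup-map v (_∸ 1) q =
      ∸-monoˡ-< lt (proj₁ (bounds (fsuc u)))

st-avoids32-1 : ∀ {n} (x : Vec ℕ n) → IsModAscent x → Avoids x pat221 → Avoids32-1 (st x)
st-avoids32-1 x modAscent avoids221 (a , b , c , a+1≡b , b<c , st_b<st_a , st_c<st_b) =
  let d , d<b , x_d≡x_b = descent⇒repeat a+1≡b (st-descent (≤-reflexive a+1≡b) st_b<st_a) in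
  avoids221 (from (contains221⇔ x) ((d , b , c) , d<b , b<c , x_d≡x_b , st-descent b<c st_c<st_b))
  where
  open ModifiedAscent x modAscent
  open Standardization x

st-in1⊕Sym32-1 : ∀ {m} (x : Vec ℕ (suc m)) → InPrim pat221 x → In1⊕Sym32-1 (st x)
st-in1⊕Sym32-1 x (modAscent , _ , avoids221) =
  from (in1⊕Sym32-1⇔ (st x))
    (st-isPerm , rank-minimum fzero first-least , st-avoids32-1 x modAscent avoids221)
  where
  open Standardization x
  first-least : ∀ h → h ≢ fzero → fzero ≺ h
  first-least fzero    h≢0 = ⊥-elim (h≢0 refl)
  first-least (fsuc k) _
    with m≤n⇒m<n∨m≡n (subst (_≤ lookup x (fsuc k)) (sym (modAscent-head≡1 {x = x} modAscent))
                                (proj₁ (ModifiedAscent.cayley x modAscent) (fsuc k)))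
  ... | inj₁ x₀<xₕ = inj₁ x₀<xₕ
  ... | inj₂ x₀≡xₕ = inj₂ (x₀≡xₕ , s≤s z≤n)

-- The inverse of standardization

module Ranking {n} {p : Vec ℕ n} (perm : IsPerm p) (Q : Fin n → Bool) where

  private
    P = lookup p

  Counted : ℕ → Fin n → Bool
  Counted v k = Q k ∧ (P k ≤ᵇ v)

  level : ℕ → ℕ
  level v = count (Counted v)

  counted⇔ : ∀ v k → T (Counted v k) ⇔ (T (Q k) × P k ≤ v)
  counted⇔ v k = ⇔-trans T-∧ (mk⇔ (λ (q , t) → q , ≤ᵇ⇒≤ (P k) v t) (λ (q , le) → q , ≤⇒≤ᵇ le))

  level-mono : ∀ {u v} → u ≤ v → level u ≤ level v
  level-mono {u} {v} u≤v = count-mono (Counted u) (Counted v) λ k c →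
    let q , Pₖ≤u = to (counted⇔ u k) c in from (counted⇔ v k) (q , ≤-trans Pₖ≤u u≤v)

  level-< : ∀ {u v} k → T (Q k) → u < P k → P k ≤ v → level u < level v
  level-< {u} {v} k qₖ u<Pₖ Pₖ≤v = count-< (Counted u) (Counted v)
    (λ h c → let q , Pₕ≤u = to (counted⇔ u h) c in
             from (counted⇔ v h) (q , ≤-trans Pₕ≤u (≤-trans (<⇒≤ u<Pₖ) Pₖ≤v)))
    k (λ c → <⇒≱ u<Pₖ (proj₂ (to (counted⇔ u k) c))) (from (counted⇔ v k) (qₖ , Pₖ≤v))

  level-reflects-< : ∀ {u v} → level u < level v → u < v
  level-reflects-< c<c = ≰⇒> λ v≤u → <⇒≱ c<c (level-mono v≤u)

  level-zero : level 0 ≡ 0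
  level-zero = count-none (Counted 0) λ k c → <⇒≱ (proj₁ (proj₁ perm k)) (proj₂ (to (counted⇔ 0 k) c))

  private
    new-at-suc : ∀ {v k} → ¬ T (Counted v k) → T (Counted (suc v) k) → P k ≡ suc v
    new-at-suc {v} {k} ∉ ∈ with to (counted⇔ (suc v) k) ∈
    ... | q , Pₖ≤1+v = ≤-antisym Pₖ≤1+v (≰⇒> λ Pₖ≤v → ∉ (from (counted⇔ v k) (q , Pₖ≤v)))

  level-suc : ∀ v → level (suc v) ≤ suc (level v)
  level-suc v = count-≤-suc (Counted v) (Counted (suc v)) λ h h′ ∉ ∈ ∉′ ∈′ →
    proj₂ perm h h′ (trans (new-at-suc ∉ ∈) (sym (new-at-suc ∉′ ∈′)))

  -- Discrete intermediate values: level 0 = 0, and level grows by at most one per step.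
  level-attains : ∀ v {j} → 1 ≤ j → j ≤ level v → ∃[ k ] T (Q k) × P k ≤ v × level (P k) ≡ j
  level-attains zero    1≤j j≤c = ⊥-elim (<⇒≱ 1≤j (subst (_ ≤_) level-zero j≤c))
  level-attains (suc v) {j} 1≤j j≤c with j ≤? level v
  ... | yes j≤cᵥ = let k , q , Pₖ≤v , cₖ≡j = level-attains v 1≤j j≤cᵥ in k , q , m≤n⇒m≤1+n Pₖ≤v , cₖ≡j
  ... | no  j≰cᵥ with count-<⇒∃ (Counted v) (Counted (suc v)) (<-≤-trans (≰⇒> j≰cᵥ) j≤c)
  ...   | k , ∉ , ∈ = k , proj₁ (to (counted⇔ (suc v) k) ∈) , ≤-reflexive Pₖ≡1+v ,
                      trans (cong level Pₖ≡1+v) (≤-antisym (≤-trans (level-suc v) (≰⇒> j≰cᵥ)) j≤c)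
    where Pₖ≡1+v = new-at-suc ∉ ∈

module Inverse {m} (p : Vec ℕ (suc m)) (perm : IsPerm p) (p₀≡1 : lookup p fzero ≡ 1)
               (avoids : Avoids32-1 p) where

  open Ranking {p = p} perm (ascentTop? p)

  private
    P = lookup p

  x : Vec ℕ (suc m)
  x = tabulate (level ∘ P)

  open Standardization x using (_≺_)

  lookup-x : ∀ i → lookup x i ≡ level (P i)
  lookup-x = lookup∘tabulate (level ∘ P)

  non-top⇒descent : ∀ k → ¬ T (ascentTop? p (fsuc k)) → P (fsuc k) < P (inject₁ k)
  non-top⇒descent k ¬top = ≤∧≢⇒< (≮⇒≥ (¬top ∘ <⇒<ᵇ)) λ Pₖ₊₁≡Pₖ →
    1+n≢n (trans (cong toℕ (proj₂ perm _ _ Pₖ₊₁≡Pₖ)) (toℕ-inject₁ k))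

  later-smaller⇒lower-level : ∀ {h i} → toℕ h < toℕ i → P i < P h → level (P i) < level (P h)
  later-smaller⇒lower-level {fzero} _ Pᵢ<Pₕ = level-< fzero tt Pᵢ<Pₕ ≤-refl
  later-smaller⇒lower-level {fsuc k} {i} h<i Pᵢ<Pₕ with T? (ascentTop? p (fsuc k))
  ... | yes top  = level-< (fsuc k) top Pᵢ<Pₕ ≤-refl
  ... | no  ¬top =
    ⊥-elim (avoids (inject₁ k , fsuc k , i , inject₁-adjacent k , h<i , non-top⇒descent k ¬top , Pᵢ<Pₕ))

  same-level⇒increasing : ∀ {h i} → level (P h) ≡ level (P i) → toℕ h < toℕ i → P h < P i
  same-level⇒increasing {h} {i} cₕ≡cᵢ h<i with <-cmp (P h) (P i)
  ... | tri< Pₕ<Pᵢ _ _ = Pₕ<Pᵢ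
  ... | tri≈ _ Pₕ≡Pᵢ _ = ⊥-elim (<-irrefl (cong toℕ (proj₂ perm h i Pₕ≡Pᵢ)) h<i)
  ... | tri> _ _ Pᵢ<Pₕ = ⊥-elim (<-irrefl (sym cₕ≡cᵢ) (later-smaller⇒lower-level h<i Pᵢ<Pₕ))

  private
    x≡⇒level≡ : ∀ {h i} → lookup x h ≡ lookup x i → level (P h) ≡ level (P i)
    x≡⇒level≡ {h} {i} eq = trans (sym (lookup-x h)) (trans eq (lookup-x i))

    x<⇒level< : ∀ {h i} → lookup x h < lookup x i → level (P h) < level (P i)
    x<⇒level< {h} {i} = subst₂ _<_ (lookup-x h) (lookup-x i)

  ≺⇒p< : ∀ {h i} → h ≺ i → P h < P i
  ≺⇒p< (inj₁ xₕ<xᵢ)         = level-reflects-< (x<⇒level< xₕ<xᵢ)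
  ≺⇒p< (inj₂ (xₕ≡xᵢ , h<i)) = same-level⇒increasing (x≡⇒level≡ xₕ≡xᵢ) h<i

  st-x≡p : st x ≡ p
  st-x≡p = Standardization.st-unique x perm ≺⇒p<

  x-positive : ∀ i → 1 ≤ lookup x i
  x-positive i = subst₂ _<_ level-zero (sym (lookup-x i))
    (level-< fzero tt (subst (0 <_) (sym p₀≡1) (s≤s z≤n))
                      (subst (_≤ P i) (sym p₀≡1) (proj₁ (proj₁ perm i))))

  x-isCayley : IsCayley x
  x-isCayley = x-positive , values-attained
    where
    values-attained : ∀ j → 1 ≤ j → j ≤ maxV x → ∃[ i ] lookup x i ≡ j
    values-attained j 1≤j j≤max with maxV-attained x
    ... | i , max≡xᵢ with level-attains (P i) 1≤j (subst (j ≤_) (trans max≡xᵢ (lookup-x i)) j≤max)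
    ...   | k , _ , _ , cₖ≡j = k , trans (lookup-x k) cₖ≡j

  ascentTops-agree : ∀ i → T (ascentTop? x i) ⇔ T (ascentTop? p i)
  ascentTops-agree fzero    = mk⇔ id id
  ascentTops-agree (fsuc k) = mk⇔
    (λ t → <⇒<ᵇ (level-reflects-< (x<⇒level< (<ᵇ⇒< _ _ t))))
    (λ top → <⇒<ᵇ (subst₂ _<_ (sym (lookup-x (inject₁ k))) (sym (lookup-x (fsuc k)))
                     (level-< (fsuc k) top (<ᵇ⇒< _ _ top) ≤-refl)))

  top⇒leftmost : ∀ {i} → T (ascentTop? p i) → Leftmost x i
  top⇒leftmost {i} top h xₕ≡xᵢ = ≮⇒≥ λ h<i →
    <-irrefl (x≡⇒level≡ xₕ≡xᵢ) (level-< i top (same-level⇒increasing (x≡⇒level≡ xₕ≡xᵢ) h<i) ≤-refl)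

  leftmost⇒top : ∀ {i} → Leftmost x i → T (ascentTop? p i)
  leftmost⇒top {i} min with T? (ascentTop? p i)
  ... | yes top  = top
  ... | no  ¬top with level-attains (P i) (subst (1 ≤_) (lookup-x i) (x-positive i)) ≤-refl
  ...   | k , topₖ , Pₖ≤Pᵢ , cₖ≡cᵢ = ⊥-elim (<⇒≱ (same-level⇒increasing (sym cₖ≡cᵢ) i<k) Pₖ≤Pᵢ)
    where
    k≢i : k ≢ i
    k≢i refl = ¬top topₖ
    i<k : toℕ i < toℕ k
    i<k = ≤∧≢⇒< (min k (trans (lookup-x k) (trans cₖ≡cᵢ (sym (lookup-x i)))))
                (k≢i ∘ sym ∘ toℕ-injective)

  x-isModAscent : IsModAscent x
  x-isModAscent = from (isModAscent⇔ x)
    (x-isCayley , λ i → ⇔-trans (ascentTops-agree i) (mk⇔ top⇒leftmost leftmost⇒top))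

  x-isPrimitive : IsPrimitive x
  x-isPrimitive i j i+1≡j xᵢ≡xⱼ = <⇒≱ (≤-reflexive i+1≡j) (top⇒leftmost topⱼ i xᵢ≡xⱼ)
    where
    topⱼ : T (ascentTop? p j)
    topⱼ = subst T (sym (ascentTop?-adjacent p i+1≡j))
             (<⇒<ᵇ (same-level⇒increasing (x≡⇒level≡ xᵢ≡xⱼ) (≤-reflexive i+1≡j)))

  x-avoids221 : Avoids x pat221
  x-avoids221 occurs with to (contains221⇔ x) occurs
  ... | (a , fsuc k , c) , a<b , b<c , xₐ≡x_b , x_c<x_b with T? (ascentTop? p (fsuc k))
  ...   | yes top  = <⇒≱ a<b (top⇒leftmost top a xₐ≡x_b)
  ...   | no  ¬top = avoids (inject₁ k , fsuc k , c , inject₁-adjacent k , b<c , non-top⇒descent k ¬top ,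
                             level-reflects-< (x<⇒level< x_c<x_b))

  x-inPrim : InPrim pat221 x
  x-inPrim = x-isModAscent , x-isPrimitive , x-avoids221

proposition6p1 :
    ((n : ℕ) (x : Vec ℕ n) → InPrim pat221 x ⇔ InPrim pat2321 x) ×
    ((m : ℕ) (p : Vec ℕ (suc m)) →
       (Σ (Vec ℕ (suc m)) λ x → InPrim pat221 x × st x ≡ p) ⇔ In1⊕Sym32-1 p)
proposition6p1 = prim221⇔prim2321 , st-image
  where
  prim221⇔prim2321 : (n : ℕ) (x : Vec ℕ n) → InPrim pat221 x ⇔ InPrim pat2321 x
  prim221⇔prim2321 n x = mk⇔
    (λ (modAscent , prim , avoids221) → modAscent , prim , avoids221⇒avoids2321 x avoids221)
    (λ (modAscent , prim , avoids2321) →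
       modAscent , prim , avoids2321 ∘ ModifiedAscent.221⇒2321 x modAscent prim)

  st-image : (m : ℕ) (p : Vec ℕ (suc m)) →
    (Σ (Vec ℕ (suc m)) λ x → InPrim pat221 x × st x ≡ p) ⇔ In1⊕Sym32-1 p
  st-image m p = mk⇔
    (λ (x , inPrim , st≡p) → subst In1⊕Sym32-1 st≡p (st-in1⊕Sym32-1 x inPrim))
    (λ inSym → let perm , p₀≡1 , avoids = to (in1⊕Sym32-1⇔ p) inSym
                   open Inverse p perm p₀≡1 avoids
               in x , x-inPrim , st-x≡p)
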